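{- Let $(G,\sigma)$ be a cubic signed graph with a circuit double cover $\mathcal F$. If $v$ is a vertex of degree 3 in a barbell $B\in\mathcal F$, then $v$ is a vertex of degree 3 in another barbell $B'\in\mathcal F$ (with $B'\neq B$ as members of $\mathcal F$).
   Context: A signed graph $(G,\sigma)$ is a graph with $\sigma:E(G)\to\{ -1,+1\}$; edges with $\sigma=-1$ are negative. A cycle is a connected 2-regular subgraph; it is positive if it has an even number of negative edges, negative otherwise. A barbell is a pair of edge-disjoint negative cycles joined by a path (possibly of length zero); a circuit is a positive cycle or a barbell. A circuit double cover of $(G,\sigma)$ is a family of circuits such that every edge of $G$ belongs to exactly two members of the family. -}

module Defs where

open import Data.Nat using (ℕ; zero; suc; _+_; _%_)
open import Data.Bool using (Bool; true; false; if_then_else_)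
open import Data.Fin using (Fin; zero; suc; _≟_)
open import Data.Product using (_×_; _,_; proj₁; proj₂; ∃; ∃-syntax; Σ-syntax)
open import Data.Sum using (_⊎_)
open import Data.Sign using (Sign)
open import Data.List using (List; []; _∷_)
open import Data.List.Membership.Propositional using (_∈_)
open import Data.List.Relation.Unary.Unique.Propositional using (Unique)
open import Relation.Binary.PropositionalEquality using (_≡_)
open import Relation.Nullary using (¬_)
open import Relation.Nullary.Decidable using (⌊_⌋)
open import Function.Bundles using (_⇔_)

sumFin : ∀ {n} → (Fin n → ℕ) → ℕ
sumFin {zero}  f = 0
sumFin {suc n} f = f zero + sumFin (λ i → f (suc i))

countFin : ∀ {n} → (Fin n → Bool) → ℕ
countFin b = sumFin (λ i → if b i then 1 else 0)

-- A finite signed (multi)graph: vertices Fin nV, edges Fin nE, each edge has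
-- two ends (loops and parallel edges allowed), and a sign σ e ∈ {-,+}.
record SignedGraph : Set where
  field
    nV   : ℕ
    nE   : ℕ
    ends : Fin nE → Fin nV × Fin nV
    σ    : Fin nE → Sign

module _ (G : SignedGraph) where
  open SignedGraph G

  -- A subgraph without isolated vertices is given by its edge set.
  EdgeSet : Set
  EdgeSet = Fin nE → Bool

  allEdges : EdgeSet
  allEdges _ = true

  -- number of ends of edge e equal to v (a loop at v counts 2)
  incidence : Fin nE → Fin nV → ℕ
  incidence e v = (if ⌊ proj₁ (ends e) ≟ v ⌋ then 1 else 0)
                + (if ⌊ proj₂ (ends e) ≟ v ⌋ then 1 else 0)

  deg : EdgeSet → Fin nV → ℕ
  deg S v = sumFin (λ e → if S e then incidence e v else 0)

  Cubic : Set
  Cubic = ∀ v → deg allEdges v ≡ 3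

  Touches : EdgeSet → Fin nV → Set
  Touches S v = ¬ (deg S v ≡ 0)

  Joins : Fin nE → Fin nV → Fin nV → Set
  Joins e u x = ends e ≡ (u , x) ⊎ ends e ≡ (x , u)

  data WalkIn (S : EdgeSet) : Fin nV → Fin nV → Set where
    here : ∀ {u} → WalkIn S u u
    step : ∀ {u x w} (e : Fin nE) → S e ≡ true → Joins e u x → WalkIn S x w → WalkIn S u w

  Connected : EdgeSet → Set
  Connected S = ∀ u w → Touches S u → Touches S w → WalkIn S u w

  negCount : EdgeSet → ℕ
  negCount S = countFin (λ e → if S e then ⌊ σ e Data.Sign.≟ Sign.- ⌋ else false)

  IsCycle : EdgeSet → Set
  IsCycle C = (∃[ e ] C e ≡ true)
            × (∀ v → deg C v ≡ 0 ⊎ deg C v ≡ 2)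
            × Connected C

  IsPositiveCycle : EdgeSet → Set
  IsPositiveCycle C = IsCycle C × negCount C % 2 ≡ 0

  IsNegativeCycle : EdgeSet → Set
  IsNegativeCycle C = IsCycle C × negCount C % 2 ≡ 1

  data Walk : Fin nV → Fin nV → Set where
    nil  : ∀ {u} → Walk u u
    cons : ∀ {u x w} (e : Fin nE) → Joins e u x → Walk x w → Walk u w

  walkVerts : ∀ {a b} → Walk a b → List (Fin nV)
  walkVerts {a} nil = a ∷ []
  walkVerts {a} (cons e _ p) = a ∷ walkVerts p

  walkEdges : ∀ {a b} → Walk a b → List (Fin nE)
  walkEdges nil = []
  walkEdges (cons e _ p) = e ∷ walkEdges p

  IsPath : ∀ {a b} → Walk a b → Set
  IsPath p = Unique (walkVerts p)

  -- A barbell: two edge-disjoint negative cycles C₁, C₂ and a path P from a ∈ C₁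
  -- to b ∈ C₂ meeting C₁ only in a and C₂ only in b; C₁ and C₂ share no vertex
  -- except when P has length zero (a ≡ b), in which case they share only a.
  IsBarbell : EdgeSet → Set
  IsBarbell B =
    Σ[ C₁ ∈ EdgeSet ] Σ[ C₂ ∈ EdgeSet ] Σ[ a ∈ Fin nV ] Σ[ b ∈ Fin nV ] Σ[ P ∈ Walk a b ]
      IsNegativeCycle C₁ × IsNegativeCycle C₂
    × (∀ e → C₁ e ≡ true → C₂ e ≡ false)
    × IsPath P
    × Touches C₁ a × Touches C₂ b
    × (∀ v → v ∈ walkVerts P → Touches C₁ v → v ≡ a)
    × (∀ v → v ∈ walkVerts P → Touches C₂ v → v ≡ b)
    × (∀ v → Touches C₁ v → Touches C₂ v → v ≡ a × v ≡ b)
    × (∀ e → (B e ≡ true) ⇔ (C₁ e ≡ true ⊎ C₂ e ≡ true ⊎ e ∈ walkEdges P))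

  IsCircuit : EdgeSet → Set
  IsCircuit C = IsPositiveCycle C ⊎ IsBarbell C

  -- a circuit double cover: a finite family (indexed by Fin size, repetitions
  -- allowed) of circuits covering each edge exactly twice
  record CircuitDoubleCover : Set where
    field
      size      : ℕ
      member    : Fin size → EdgeSet
      circuits  : ∀ i → IsCircuit (member i)
      twice     : ∀ e → countFin (λ i → member i e) ≡ 2

-- Counting incidences at v over the cover, every edge at v is counted twice, so the degrees of
-- v in the members of 𝓕 sum to 2 · 3 = 6. The barbell B contributes the odd number 3, hence
-- some other member contributes an odd number, which is at most 6 − 3 = 3. A positive cycle
-- has even degree everywhere, so that member is a barbell; and a barbell has no vertex of
-- degree 1 (such a vertex would be an end of its path lying on one of its cycles, or an
-- inner vertex of the path), so its degree at v is 3.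
module Submission where

open import Defs

open import Data.Bool using (Bool; true; false; if_then_else_)
open import Data.Empty using (⊥-elim)
open import Data.Fin using (Fin; zero; suc; punchIn; punchOut; _≟_)
open import Data.Fin.Properties using (punchInᵢ≢i; punchIn-punchOut; ¬∀⟶∃¬)
open import Data.List.Membership.Propositional using (_∈_)
import Data.List.Relation.Unary.All as All
open import Data.List.Relation.Unary.AllPairs using (_∷_)
open import Data.List.Relation.Unary.Any using (here; there)
open import Data.Nat using (ℕ; zero; suc; _+_; _*_; _≤_; z≤n; s≤s)
open import Data.Nat.Divisibility using (_∣_; _∣?_; ∣m∣n⇒∣m+n; ∣m+n∣m⇒∣n; ∣-refl; divides)
open import Data.Nat.Properties
  using (+-*-semiring; +-comm; +-identityʳ; ≤-refl; ≤-trans; +-mono-≤; +-monoʳ-≤; +-cancelˡ-≤; m≤m+n; m≤n+m; 0≢1+n; n>0⇒n≢0;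
         module ≤-Reasoning)
open import Algebra.Properties.Semiring.Sum +-*-semiring
  using (sum; sum-cong-≗; sum-remove; ∑-comm; *-distribʳ-sum; *-distribˡ-sum)
open import Data.Product using (_×_; _,_; proj₁; proj₂; ∃-syntax)
open import Data.Sum using (_⊎_; inj₁; inj₂)
open import Function using (_∘_)
open import Function.Bundles using (Equivalence)
open import Relation.Binary.PropositionalEquality
  using (_≡_; _≢_; refl; sym; trans; cong; cong₂; subst; subst₂; module ≡-Reasoning)
open import Relation.Nullary using (¬_; yes; no)

sumFin≗sum : ∀ {n} (f : Fin n → ℕ) → sumFin f ≡ sum f
sumFin≗sum {zero}  f = refl
sumFin≗sum {suc n} f = cong (f zero +_) (sumFin≗sum (f ∘ suc))

lookup≤sum : ∀ {n} (f : Fin n → ℕ) i → f i ≤ sum f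
lookup≤sum f zero    = m≤m+n _ _
lookup≤sum f (suc i) = ≤-trans (lookup≤sum (f ∘ suc) i) (m≤n+m _ (f zero))

lookup+lookup≤sum : ∀ {n} (f : Fin n → ℕ) {i j} → i ≢ j → f i + f j ≤ sum f
lookup+lookup≤sum {suc n} f {i} {j} i≢j = subst (f i + f j ≤_) (sym (sum-remove f)) (+-monoʳ-≤ (f i) fj≤rest)
  where
  fj≤rest : f j ≤ sum (f ∘ punchIn i)
  fj≤rest = subst (λ k → f k ≤ sum (f ∘ punchIn i)) (punchIn-punchOut i≢j) (lookup≤sum (f ∘ punchIn i) (punchOut i≢j))

sum-mono-≤ : ∀ {n} (f g : Fin n → ℕ) → (∀ i → f i ≤ g i) → sum f ≤ sum g
sum-mono-≤ {zero}  f g f≤g = z≤n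
sum-mono-≤ {suc n} f g f≤g = +-mono-≤ (f≤g zero) (sum-mono-≤ (f ∘ suc) (g ∘ suc) (f≤g ∘ suc))

sum≢0⇒∃≢0 : ∀ {n} (f : Fin n → ℕ) → sum f ≢ 0 → ∃[ i ] f i ≢ 0
sum≢0⇒∃≢0 {zero}  f sum≢0 = ⊥-elim (sum≢0 refl)
sum≢0⇒∃≢0 {suc n} f sum≢0 with f zero in f0≡
... | suc _ = zero , λ f0≡0 → 0≢1+n (trans (sym f0≡0) f0≡)
... | zero with sum≢0⇒∃≢0 (f ∘ suc) sum≢0
...   | i , fi≢0 = suc i , fi≢0

∣-sum : ∀ {d n} (f : Fin n → ℕ) → (∀ i → d ∣ f i) → d ∣ sum f
∣-sum {n = zero}  f d∣f = divides 0 refl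
∣-sum {n = suc n} f d∣f = ∣m∣n⇒∣m+n (d∣f zero) (∣-sum (f ∘ suc) (d∣f ∘ suc))

sum-indicator : ∀ {n} (b : Fin n → Bool) c → sum (λ i → if b i then c else 0) ≡ countFin b * c
sum-indicator b c = begin
  sum (λ i → if b i then c else 0)      ≡⟨ sum-cong-≗ (λ i → indicator-scale (b i)) ⟩
  sum (λ i → (if b i then 1 else 0) * c) ≡⟨ sym (*-distribʳ-sum c (λ i → if b i then 1 else 0)) ⟩
  sum (λ i → if b i then 1 else 0) * c   ≡⟨ cong (_* c) (sym (sumFin≗sum (λ i → if b i then 1 else 0))) ⟩
  countFin b * c                         ∎
  where
  open ≡-Reasoning
  indicator-scale : ∀ x → (if x then c else 0) ≡ (if x then 1 else 0) * c
  indicator-scale true  = sym (+-identityʳ c)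
  indicator-scale false = refl

sum-another-odd : ∀ {n} (f : Fin n → ℕ) i → 2 ∣ sum f → ¬ 2 ∣ f i →
  ∃[ j ] (j ≢ i × ¬ 2 ∣ f j × f i + f j ≤ sum f)
sum-another-odd {suc n} f i 2∣sum 2∤fi =
  let k , 2∤fk = ¬∀⟶∃¬ n (λ k → 2 ∣ f (punchIn i k)) (λ k → 2 ∣? f (punchIn i k)) rest-not-even
  in punchIn i k , punchInᵢ≢i i k , 2∤fk , lookup+lookup≤sum f (punchInᵢ≢i i k ∘ sym)
  where
  rest-not-even : ¬ (∀ k → 2 ∣ f (punchIn i k))
  rest-not-even rest-even = 2∤fi (∣m+n∣m⇒∣n (subst (2 ∣_) (+-comm (f i) _) 2∣fi+rest) 2∣rest)
    where
    2∣rest : 2 ∣ sum (f ∘ punchIn i)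
    2∣rest = ∣-sum (f ∘ punchIn i) rest-even
    2∣fi+rest : 2 ∣ f i + sum (f ∘ punchIn i)
    2∣fi+rest = subst (2 ∣_) (sum-remove f) 2∣sum

module _ (G : SignedGraph) where
  open SignedGraph G

  Incident : Fin nE → Fin nV → Set
  Incident e v = proj₁ (ends e) ≡ v ⊎ proj₂ (ends e) ≡ v

  _⊆_ : EdgeSet G → EdgeSet G → Set
  S ⊆ T = ∀ e → S e ≡ true → T e ≡ true

  Incident⇒incidence≥1 : ∀ {e v} → Incident e v → 1 ≤ incidence G e v
  Incident⇒incidence≥1 {e} {v} (inj₁ x≡v) with proj₁ (ends e) ≟ v
  ... | yes _   = s≤s z≤n
  ... | no x≢v  = ⊥-elim (x≢v x≡v)
  Incident⇒incidence≥1 {e} {v} (inj₂ y≡v) with proj₂ (ends e) ≟ v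
  ... | yes _   = m≤n+m 1 _
  ... | no y≢v  = ⊥-elim (y≢v y≡v)

  incidence≢0⇒Incident : ∀ {e v} → incidence G e v ≢ 0 → Incident e v
  incidence≢0⇒Incident {e} {v} incidence≢0 with proj₁ (ends e) ≟ v | proj₂ (ends e) ≟ v
  ... | yes x≡v | _       = inj₁ x≡v
  ... | no _    | yes y≡v = inj₂ y≡v
  ... | no _    | no _    = ⊥-elim (incidence≢0 refl)

  degTerm : EdgeSet G → Fin nV → Fin nE → ℕ
  degTerm S v e = if S e then incidence G e v else 0

  deg≡sum : ∀ S v → deg G S v ≡ sum (degTerm S v)
  deg≡sum S v = sumFin≗sum (degTerm S v)

  degTerm-∈ : ∀ S {e} v → S e ≡ true → degTerm S v e ≡ incidence G e v
  degTerm-∈ S v Se rewrite Se = refl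

  deg-mono : ∀ {S T} v → S ⊆ T → deg G S v ≤ deg G T v
  deg-mono {S} {T} v S⊆T = subst₂ _≤_ (sym (deg≡sum S v)) (sym (deg≡sum T v))
    (sum-mono-≤ (degTerm S v) (degTerm T v) term-mono)
    where
    term-mono : ∀ e → degTerm S v e ≤ degTerm T v e
    term-mono e with S e in Se
    ... | false = z≤n
    ... | true  rewrite S⊆T e Se = ≤-refl

  Incident⇒Touches : ∀ {S e v} → S e ≡ true → Incident e v → Touches G S v
  Incident⇒Touches {S} {e} {v} Se inc = n>0⇒n≢0 (begin
    1                  ≤⟨ Incident⇒incidence≥1 inc ⟩
    incidence G e v    ≡⟨ sym (degTerm-∈ S v Se) ⟩
    degTerm S v e      ≤⟨ lookup≤sum (degTerm S v) e ⟩
    sum (degTerm S v)  ≡⟨ sym (deg≡sum S v) ⟩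
    deg G S v          ∎)
    where open ≤-Reasoning

  Touches⇒∃Incident : ∀ {S v} → Touches G S v → ∃[ e ] (S e ≡ true × Incident e v)
  Touches⇒∃Incident {S} {v} deg≢0 with sum≢0⇒∃≢0 (degTerm S v) (deg≢0 ∘ trans (deg≡sum S v))
  ... | e , term≢0 with S e in Se
  ...   | true  = e , Se , incidence≢0⇒Incident term≢0
  ...   | false = ⊥-elim (term≢0 refl)

  two-Incident⇒deg≥2 : ∀ {S e e' v} → e ≢ e' → S e ≡ true → S e' ≡ true →
    Incident e v → Incident e' v → 2 ≤ deg G S v
  two-Incident⇒deg≥2 {S} {e} {e'} {v} e≢e' Se Se' inc inc' = begin
    2                                    ≤⟨ +-mono-≤ (Incident⇒incidence≥1 inc) (Incident⇒incidence≥1 inc') ⟩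
    incidence G e v + incidence G e' v    ≡⟨ sym (cong₂ _+_ (degTerm-∈ S v Se) (degTerm-∈ S v Se')) ⟩
    degTerm S v e + degTerm S v e'        ≤⟨ lookup+lookup≤sum (degTerm S v) e≢e' ⟩
    sum (degTerm S v)                    ≡⟨ sym (deg≡sum S v) ⟩
    deg G S v                            ∎
    where open ≤-Reasoning

  cycle-deg-even : ∀ {C} → IsCycle G C → ∀ v → 2 ∣ deg G C v
  cycle-deg-even (_ , deg∈0,2 , _) v with deg∈0,2 v
  ... | inj₁ deg≡0 = subst (2 ∣_) (sym deg≡0) (divides 0 refl)
  ... | inj₂ deg≡2 = subst (2 ∣_) (sym deg≡2) ∣-refl

  cycle⊆⇒deg≥2 : ∀ {C B v} → IsCycle G C → C ⊆ B → Touches G C v → 2 ≤ deg G B v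
  cycle⊆⇒deg≥2 {C} {B} {v} (_ , deg∈0,2 , _) C⊆B touches with deg∈0,2 v
  ... | inj₁ deg≡0 = ⊥-elim (touches deg≡0)
  ... | inj₂ deg≡2 = subst (_≤ deg G B v) deg≡2 (deg-mono v C⊆B)

  Joins⇒Incident-source : ∀ {e u x} → Joins G e u x → Incident e u
  Joins⇒Incident-source (inj₁ ends≡) = inj₁ (cong proj₁ ends≡)
  Joins⇒Incident-source (inj₂ ends≡) = inj₂ (cong proj₂ ends≡)

  Joins⇒Incident-target : ∀ {e u x} → Joins G e u x → Incident e x
  Joins⇒Incident-target (inj₁ ends≡) = inj₂ (cong proj₂ ends≡)
  Joins⇒Incident-target (inj₂ ends≡) = inj₁ (cong proj₁ ends≡)

  Joins-Incident : ∀ {e u x w} → Joins G e u x → Incident e w → w ≡ u ⊎ w ≡ x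
  Joins-Incident (inj₁ ends≡) (inj₁ refl) = inj₁ (cong proj₁ ends≡)
  Joins-Incident (inj₁ ends≡) (inj₂ refl) = inj₂ (cong proj₂ ends≡)
  Joins-Incident (inj₂ ends≡) (inj₁ refl) = inj₂ (cong proj₁ ends≡)
  Joins-Incident (inj₂ ends≡) (inj₂ refl) = inj₁ (cong proj₂ ends≡)

  source∈walkVerts : ∀ {a b} (p : Walk G a b) → a ∈ walkVerts G p
  source∈walkVerts nil          = here refl
  source∈walkVerts (cons _ _ _) = here refl

  Incident⇒∈walkVerts : ∀ {a b e w} (p : Walk G a b) → e ∈ walkEdges G p → Incident e w → w ∈ walkVerts G p
  Incident⇒∈walkVerts (cons _ j p) (here refl) inc with Joins-Incident j inc
  ... | inj₁ refl = here refl
  ... | inj₂ refl = there (source∈walkVerts p)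
  Incident⇒∈walkVerts (cons _ _ p) (there e∈p) inc = there (Incident⇒∈walkVerts p e∈p inc)

  path-Incident : ∀ {a b e v} (p : Walk G a b) → IsPath G p → e ∈ walkEdges G p → Incident e v →
    v ≡ a ⊎ v ≡ b ⊎ ∃[ e' ] (e' ∈ walkEdges G p × e' ≢ e × Incident e' v)
  path-Incident (cons e₀ j p) _ (here refl) inc with Joins-Incident j inc
  ... | inj₁ v≡a = inj₁ v≡a
  path-Incident (cons e₀ j nil) _ (here refl) inc | inj₂ v≡b = inj₂ (inj₁ v≡b)
  path-Incident (cons e₀ j (cons e₁ j₁ p)) (a∉p ∷ _) (here refl) inc | inj₂ refl =
    inj₂ (inj₂ (e₁ , there (here refl) , e₁≢e₀ , Joins⇒Incident-source j₁))
    where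
    -- if e₁ = e₀, the start of the path is an end of e₁ too, hence a later vertex of the path
    e₁≢e₀ : e₁ ≢ e₀
    e₁≢e₀ refl with Joins-Incident j₁ (Joins⇒Incident-source j)
    ... | inj₁ a≡x = All.head a∉p a≡x
    ... | inj₂ a≡y = All.lookup a∉p (there (source∈walkVerts p)) a≡y
  path-Incident (cons e₀ j p) (a∉p ∷ p-path) (there e∈p) inc with path-Incident p p-path e∈p inc
  ... | inj₂ (inj₁ v≡b) = inj₂ (inj₁ v≡b)
  ... | inj₂ (inj₂ (e' , e'∈p , e'≢e , inc')) = inj₂ (inj₂ (e' , there e'∈p , e'≢e , inc'))
  ... | inj₁ refl = inj₂ (inj₂ (e₀ , here refl , e₀≢e , Joins⇒Incident-target j))
    where
    e₀≢e : e₀ ≢ _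
    e₀≢e refl = All.lookup a∉p (Incident⇒∈walkVerts p e∈p (Joins⇒Incident-source j)) refl

  barbell-deg≥2 : ∀ {B v} → IsBarbell G B → Touches G B v → 2 ≤ deg G B v
  barbell-deg≥2 {B} {v} (C₁ , C₂ , a , b , P , (C₁-cycle , _) , (C₂-cycle , _) , _ , P-path
                         , C₁-touches-a , C₂-touches-b , _ , _ , _ , B⇔) touches
    = at-edge (Touches⇒∃Incident touches)
    where
    C₁⊆B : C₁ ⊆ B
    C₁⊆B e C₁e = Equivalence.from (B⇔ e) (inj₁ C₁e)

    C₂⊆B : C₂ ⊆ B
    C₂⊆B e C₂e = Equivalence.from (B⇔ e) (inj₂ (inj₁ C₂e))

    P⊆B : ∀ {e} → e ∈ walkEdges G P → B e ≡ true
    P⊆B {e} e∈P = Equivalence.from (B⇔ e) (inj₂ (inj₂ e∈P))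

    at-path-edge : ∀ {e} → e ∈ walkEdges G P → Incident e v → 2 ≤ deg G B v
    at-path-edge e∈P inc with path-Incident P P-path e∈P inc
    ... | inj₁ refl        = cycle⊆⇒deg≥2 C₁-cycle C₁⊆B C₁-touches-a
    ... | inj₂ (inj₁ refl) = cycle⊆⇒deg≥2 C₂-cycle C₂⊆B C₂-touches-b
    ... | inj₂ (inj₂ (e' , e'∈P , e'≢e , inc')) = two-Incident⇒deg≥2 (e'≢e ∘ sym) (P⊆B e∈P) (P⊆B e'∈P) inc inc'

    at-edge : ∃[ e ] (B e ≡ true × Incident e v) → 2 ≤ deg G B v
    at-edge (e , Be , inc) with Equivalence.to (B⇔ e) Be
    ... | inj₁ C₁e        = cycle⊆⇒deg≥2 C₁-cycle C₁⊆B (Incident⇒Touches C₁e inc)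
    ... | inj₂ (inj₁ C₂e) = cycle⊆⇒deg≥2 C₂-cycle C₂⊆B (Incident⇒Touches C₂e inc)
    ... | inj₂ (inj₂ e∈P) = at-path-edge e∈P inc

  sum-deg-uniform-cover : ∀ {m} (S : Fin m → EdgeSet G) k → (∀ e → countFin (λ j → S j e) ≡ k) →
    ∀ v → sum (λ j → deg G (S j) v) ≡ k * deg G (allEdges G) v
  sum-deg-uniform-cover S k covers v = begin
    sum (λ j → deg G (S j) v)                 ≡⟨ sum-cong-≗ (λ j → deg≡sum (S j) v) ⟩
    sum (λ j → sum (degTerm (S j) v))         ≡⟨ ∑-comm (λ j e → degTerm (S j) v e) ⟩
    sum (λ e → sum (λ j → degTerm (S j) v e)) ≡⟨ sum-cong-≗ edge-counted-k-times ⟩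
    sum (λ e → k * incidence G e v)           ≡⟨ sym (*-distribˡ-sum k (λ e → incidence G e v)) ⟩
    k * sum (λ e → incidence G e v)           ≡⟨ cong (k *_) (sym (deg≡sum (allEdges G) v)) ⟩
    k * deg G (allEdges G) v                  ∎
    where
    open ≡-Reasoning
    edge-counted-k-times : ∀ e → sum (λ j → degTerm (S j) v e) ≡ k * incidence G e v
    edge-counted-k-times e = trans (sum-indicator (λ j → S j e) (incidence G e v))
                                   (cong (_* incidence G e v) (covers e))

  circuit-odd-deg⇒barbell : ∀ {C v} → IsCircuit G C → ¬ 2 ∣ deg G C v → IsBarbell G C
  circuit-odd-deg⇒barbell {v = v} (inj₁ (C-cycle , _)) 2∤deg = ⊥-elim (2∤deg (cycle-deg-even C-cycle v))
  circuit-odd-deg⇒barbell         (inj₂ C-barbell)     _     = C-barbell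

  barbell-odd-deg≤3⇒deg≡3 : ∀ {B v} → IsBarbell G B → ¬ 2 ∣ deg G B v → deg G B v ≤ 3 → deg G B v ≡ 3
  barbell-odd-deg≤3⇒deg≡3 B-barbell 2∤deg deg≤3 =
    odd-in-[2,3] (barbell-deg≥2 B-barbell (λ deg≡0 → 2∤deg (subst (2 ∣_) (sym deg≡0) (divides 0 refl)))) deg≤3 2∤deg
    where
    odd-in-[2,3] : ∀ {n} → 2 ≤ n → n ≤ 3 → ¬ 2 ∣ n → n ≡ 3
    odd-in-[2,3] {1} (s≤s ()) _ _
    odd-in-[2,3] {2} _ _ 2∤2 = ⊥-elim (2∤2 ∣-refl)
    odd-in-[2,3] {3} _ _ _   = refl
    odd-in-[2,3] {suc (suc (suc (suc n)))} _ (s≤s (s≤s (s≤s ()))) _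

proposition4p1 : (G : SignedGraph) → Cubic G → (𝓕 : CircuitDoubleCover G)
    → (i : Fin (CircuitDoubleCover.size 𝓕)) → (v : Fin (SignedGraph.nV G))
    → IsBarbell G (CircuitDoubleCover.member 𝓕 i)
    → deg G (CircuitDoubleCover.member 𝓕 i) v ≡ 3
    → ∃[ j ] (j ≢ i × IsBarbell G (CircuitDoubleCover.member 𝓕 j)
              × deg G (CircuitDoubleCover.member 𝓕 j) v ≡ 3)
proposition4p1 G cubic 𝓕 i v _ Di≡3 =
  let j , j≢i , 2∤Dj , Di+Dj≤sumD = sum-another-odd D i 2∣sumD 2∤Di
      j-barbell = circuit-odd-deg⇒barbell G (circuits j) 2∤Dj
      Dj≤3 = +-cancelˡ-≤ 3 _ _ (subst₂ (λ x y → x + D j ≤ y) Di≡3 sumD≡6 Di+Dj≤sumD)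
  in j , j≢i , j-barbell , barbell-odd-deg≤3⇒deg≡3 G j-barbell 2∤Dj Dj≤3
  where
  open CircuitDoubleCover 𝓕

  D : Fin size → ℕ
  D j = deg G (member j) v

  sumD≡6 : sum D ≡ 6
  sumD≡6 = trans (sum-deg-uniform-cover G member 2 twice v) (cong (2 *_) (cubic v))

  2∣sumD : 2 ∣ sum D
  2∣sumD = subst (2 ∣_) (sym sumD≡6) (divides 3 refl)

  2∤Di : ¬ 2 ∣ D i
  2∤Di 2∣Di with subst (2 ∣_) Di≡3 2∣Di
  ... | divides (suc zero) ()
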